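{- Let $f:\{ -1,1\}^n\to\{ -1,1\}$ and suppose $|\widehat f(\{1\})|\ge\kappa$ where $\kappa\in(0,1)$. Let $\alpha=\kappa^3/16$. Choose a random $\boldsymbol{\eta}\in\{0,\alpha\}^n$ with $\Pr[\boldsymbol{\eta}_i=\alpha]=\kappa^6/16$, independently for each $i$. Then with probability at least $\Omega(\kappa^6)$ over $\boldsymbol{\eta}$, for every $x\in\{ -1,1\}^n$, \[ \big|\mathsf{H}_{\boldsymbol{\eta}}f(x) - \widehat f^3(\emptyset) - \alpha\,\widehat f^3(\{1\})\,x_1\big| \le \frac{\alpha}{4}|\widehat f(\{1\})|^3. \]
   Context: Every $f:\{ -1,1\}^n\to\mathbb{R}$ has a Fourier expansion $f(x)=\sum_{S\subseteq[n]}\widehat f(S)\chi_S(x)$ with $\chi_S(x)=\prod_{i\in S}x_i$; $\widehat f^3(S)$ denotes $(\widehat f(S))^3$. For $\eta\in[-1,1]^n$, $\mathbf{Z}_\eta$ is the product distribution on $\{ -1,1\}^n$ whose $i$-th bit has expectation $\eta_i$. The operator $\mathsf{H}_\eta$ is defined by \[ \mathsf{H}_\eta f(x)=\mathbf{E}_{\mathbf{y}_1,\mathbf{y}_2,\mathbf{y}_3}[f(\mathbf{y}_1)f(\mathbf{y}_2)f(x\cdot\mathbf{y}_1\cdot\mathbf{y}_2\cdot\mathbf{y}_3)], \] where $\mathbf{y}_1,\mathbf{y}_2$ are independent uniform on $\{ -1,1\}^n$, $\mathbf{y}_3\sim\mathbf{Z}_\eta$ independently, and $\cdot$ is the coordinatewise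 product. Equivalently $\mathsf{H}_\eta f(x)=\sum_S\widehat f^3(S)\chi_S(x)\prod_{j\in S}\eta_j$.
   Formalization: The parameter κ ranges over the rationals in the interval (0,1). -}

module Defs where

open import Data.Bool using (Bool; true; false; if_then_else_)
open import Data.Nat as ℕ using (ℕ; zero; suc)
open import Data.Fin using (Fin)
open import Data.Vec using (Vec; []; _∷_; zipWith; lookup; replicate)
open import Data.List using (List; []; _∷_; map; concatMap; foldr)
open import Data.Integer using (+_)
open import Data.Rational using (ℚ; 0ℚ; 1ℚ; _+_; _*_; _-_; -_; _/_; ∣_∣; _≤_)
open import Data.Rational.Properties using (_≤?_)
open import Relation.Nullary using (does)

-- A point of {-1,1}^n is encoded as a Vec Bool n; bit false ↦ +1, true ↦ -1.
Cube : ℕ → Set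
Cube n = Vec Bool n

val : Bool → ℚ
val false = 1ℚ
val true  = - 1ℚ

coord : {n : ℕ} → Cube n → Fin n → ℚ
coord x i = val (lookup x i)

-- Coordinatewise product in {-1,1}^n is XOR of the encoding bits.
xor : Bool → Bool → Bool
xor false b = b
xor true  b = if b then false else true

_·_ : {n : ℕ} → Cube n → Cube n → Cube n
x · y = zipWith xor x y

allCube : (n : ℕ) → List (Cube n)
allCube zero    = [] ∷ []
allCube (suc n) = concatMap (λ v → (false ∷ v) ∷ (true ∷ v) ∷ []) (allCube n)

Σ : {A : Set} → List A → (A → ℚ) → ℚ
Σ xs g = foldr (λ a r → g a + r) 0ℚ xs

Πv : {n : ℕ} → Vec ℚ n → ℚ
Πv []       = 1ℚ
Πv (q ∷ qs) = q * Πv qs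

pow : ℚ → ℕ → ℚ
pow q zero    = 1ℚ
pow q (suc k) = q * pow q k

inv2^ : ℕ → ℚ
inv2^ zero    = 1ℚ
inv2^ (suc n) = (+ 1 / 2) * inv2^ n

Eu : (n : ℕ) → (Cube n → ℚ) → ℚ
Eu n g = inv2^ n * Σ (allCube n) g

-- Subsets of [n] as characteristic vectors (as in Data.Fin.Subset).
Subset : ℕ → Set
Subset n = Vec Bool n

χ : {n : ℕ} → Subset n → Cube n → ℚ
χ S x = Πv (zipWith (λ s b → if s then val b else 1ℚ) S x)

fourier : (n : ℕ) → (Cube n → ℚ) → Subset n → ℚ
fourier n f S = Eu n (λ x → f x * χ S x)

-- The empty set and the singleton {1} (coordinate index 0 here) in [n], n ≥ 1.
∅ : (n : ℕ) → Subset n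
∅ n = replicate n false

single1 : (m : ℕ) → Subset (suc m)
single1 m = true ∷ replicate m false

-- Probability mass of y under Z_η: ∏_i (1 + η_i y_i)/2.
Zη : {n : ℕ} → Vec ℚ n → Cube n → ℚ
Zη η y = Πv (zipWith (λ e b → (+ 1 / 2) * (1ℚ + e * val b)) η y)

H : (n : ℕ) → Vec ℚ n → (Cube n → ℚ) → Cube n → ℚ
H n η f x =
  Eu n (λ y₁ → Eu n (λ y₂ →
    Σ (allCube n) (λ y₃ → Zη η y₃ * (f y₁ * (f y₂ * f (((x · y₁) · y₂) · y₃))))))

allB : {A : Set} → (A → Bool) → List A → Bool
allB p []       = true
allB p (a ∷ as) = if p a then allB p as else false

leqB : ℚ → ℚ → Bool
leqB p q = does (p ≤? q)

good : (m : ℕ) → (Cube (suc m) → ℚ) → ℚ → Vec ℚ (suc m) → Bool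
good m f α η =
  allB (λ x → leqB
        ∣ H (suc m) η f x - pow (fourier (suc m) f (∅ (suc m))) 3
                          - α * pow (fourier (suc m) f (single1 m)) 3 * coord x Fin.zero ∣
        ((α * (+ 1 / 4)) * pow ∣ fourier (suc m) f (single1 m) ∣ 3))
      (allCube (suc m))
  where import Data.Fin as Fin

etaOf : {n : ℕ} → ℚ → Subset n → Vec ℚ n
etaOf α T = Data.Vec.map (λ t → if t then α else 0ℚ) T
  where import Data.Vec

-- Probability of T when each i ∈ T independently with probability p.
weight : {n : ℕ} → ℚ → Subset n → ℚ
weight p T = Πv (Data.Vec.map (λ t → if t then p else 1ℚ - p) T)
  where import Data.Vec

indicator : Bool → ℚ
indicator true  = 1ℚ
indicator false = 0ℚ

probGood : (m : ℕ) → (Cube (suc m) → ℚ) → ℚ → ℚ → ℚ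
probGood m f α p =
  Σ (allCube (suc m)) (λ T → weight p T * indicator (good m f α (etaOf α T)))

alphaOf : ℚ → ℚ
alphaOf κ = pow κ 3 * (+ 1 / 16)

pOf : ℚ → ℚ
pOf κ = pow κ 6 * (+ 1 / 16)

-- H_η f = f ∗ (f ∗ T_η f) for the convolution ∗ and the noise operator T_η; convolution multiplies
-- Fourier coefficients and T_η multiplies f̂(S) by η^S, so H_η f(x) = Σ_S f̂(S)³ η^S χ_S(x).
-- Condition on η₁ = α, an event of probability p = κ⁶/16, and write η = (α, η').  The terms
-- S = ∅ and S = {1} are exactly f̂(∅)³ + α f̂({1})³ x₁; every other S = (s, S') has S' ≠ ∅ and
-- contributes at most |f̂(S)|³ η'^S'.  As E[η'^S'] = (pα)^|S'| ≤ pα and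
-- Σ_S |f̂(S)|³ ≤ Σ_S f̂(S)² = 1, the expected error is at most pα ≤ θ/4, where
-- θ = (α/4)|f̂({1})|³ ≥ (α/4)κ³.  By Markov's inequality the error is ≤ θ with conditional
-- probability ≥ 3/4, so the good event has probability ≥ (3/4)p = (3/64)κ⁶.

{-# OPTIONS --safe #-}
module Submission where

open import Defs
open import Data.Nat using (ℕ; suc)
open import Data.Product using (Σ-syntax; _×_)
open import Data.Sum using (_⊎_)
open import Relation.Binary.PropositionalEquality using (_≡_)
open import Data.Rational using (ℚ; 0ℚ; 1ℚ; -_; _*_; _≤_; _<_; ∣_∣)

open import Level using (0ℓ)
open import Function using (_∘_)
open import Data.Bool using (Bool; true; false; if_then_else_; _∨_)
open import Data.Nat using (zero)
open import Data.Product using (_,_; proj₁; proj₂)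
open import Data.Sum using (inj₁; inj₂)
open import Data.List using (List; []; _∷_; concatMap)
open import Data.Vec using (Vec; []; _∷_; replicate; zipWith)
open import Data.Vec.Relation.Unary.All using (All; []; _∷_)
open import Data.Integer using (+_)
open import Data.Rational using (_+_; _-_; _/_; nonNegative; positive)
open import Data.Rational.Properties
open import Relation.Binary.PropositionalEquality using (refl; sym; trans; cong; cong₂; module ≡-Reasoning)
open import Relation.Nullary using (yes; no; contradiction)
open import Relation.Nullary.Decidable using (dec⇒maybe; dec-true; from-yes)
open import Tactic.RingSolver using (solve-∀)
open import Tactic.RingSolver.Core.AlmostCommutativeRing using (AlmostCommutativeRing; fromCommutativeRing)

-- The zero test must be genuine: with λ _ → nothing the solver cannot cancel constants like ½ - ½.
ℚ-ring : AlmostCommutativeRing 0ℓ 0ℓ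
ℚ-ring = fromCommutativeRing +-*-commutativeRing (λ q → dec⇒maybe (0ℚ ≟ q))

½ ¼ ¾ : ℚ
½ = + 1 / 2
¼ = + 1 / 4
¾ = + 3 / 4

_∈[0,1] : ℚ → Set
q ∈[0,1] = 0ℚ ≤ q × q ≤ 1ℚ

+-interchange : ∀ a b c d → (a + b) + (c + d) ≡ (a + c) + (b + d)
+-interchange = solve-∀ ℚ-ring

p≤p+q : ∀ {p q} → 0ℚ ≤ q → p ≤ p + q
p≤p+q {p} 0≤q = ≤-trans (≤-reflexive (sym (+-identityʳ p))) (+-monoʳ-≤ p 0≤q)

p≤1⇒0≤1-p : ∀ {p} → p ≤ 1ℚ → 0ℚ ≤ 1ℚ - p
p≤1⇒0≤1-p {p} p≤1 = ≤-trans (≤-reflexive (sym (+-inverseʳ p))) (+-monoˡ-≤ (- p) p≤1)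

*-monoˡ-≤-nonNeg′ : ∀ {r p q} → 0ℚ ≤ r → p ≤ q → r * p ≤ r * q
*-monoˡ-≤-nonNeg′ {r} 0≤r = *-monoˡ-≤-nonNeg r {{nonNegative 0≤r}}

*-monoʳ-≤-nonNeg′ : ∀ {r p q} → 0ℚ ≤ r → p ≤ q → p * r ≤ q * r
*-monoʳ-≤-nonNeg′ {r} 0≤r = *-monoʳ-≤-nonNeg r {{nonNegative 0≤r}}

*-mono-≤-nonNeg : ∀ {a b c d} → 0ℚ ≤ a → a ≤ b → 0ℚ ≤ c → c ≤ d → a * c ≤ b * d
*-mono-≤-nonNeg 0≤a a≤b 0≤c c≤d =
  ≤-trans (*-monoʳ-≤-nonNeg′ 0≤c a≤b) (*-monoˡ-≤-nonNeg′ (≤-trans 0≤a a≤b) c≤d)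

*-nonNeg : ∀ {p q} → 0ℚ ≤ p → 0ℚ ≤ q → 0ℚ ≤ p * q
*-nonNeg {p} {q} 0≤p 0≤q =
  nonNegative⁻¹ (p * q) {{nonNeg*nonNeg⇒nonNeg p {{nonNegative 0≤p}} q {{nonNegative 0≤q}}}}

*-pos : ∀ {p q} → 0ℚ < p → 0ℚ < q → 0ℚ < p * q
*-pos {p} {q} 0<p 0<q = positive⁻¹ (p * q) {{pos*pos⇒pos p {{positive 0<p}} q {{positive 0<q}}}}

0∈[0,1] : 0ℚ ∈[0,1]
0∈[0,1] = ≤-refl , nonNegative⁻¹ 1ℚ

1∈[0,1] : 1ℚ ∈[0,1]
1∈[0,1] = nonNegative⁻¹ 1ℚ , ≤-refl

*-∈[0,1] : ∀ {p q} → p ∈[0,1] → q ∈[0,1] → (p * q) ∈[0,1]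
*-∈[0,1] (0≤p , p≤1) (0≤q , q≤1) = *-nonNeg 0≤p 0≤q , *-mono-≤-nonNeg 0≤p p≤1 0≤q q≤1

pow-nonNeg : ∀ {q} → 0ℚ ≤ q → ∀ k → 0ℚ ≤ pow q k
pow-nonNeg 0≤q zero    = nonNegative⁻¹ 1ℚ
pow-nonNeg 0≤q (suc k) = *-nonNeg 0≤q (pow-nonNeg 0≤q k)

pow-pos : ∀ {q} → 0ℚ < q → ∀ k → 0ℚ < pow q k
pow-pos 0<q zero    = positive⁻¹ 1ℚ
pow-pos 0<q (suc k) = *-pos 0<q (pow-pos 0<q k)

pow-∈[0,1] : ∀ {q} → q ∈[0,1] → ∀ k → pow q k ∈[0,1]
pow-∈[0,1] q∈ zero    = 1∈[0,1]
pow-∈[0,1] q∈ (suc k) = *-∈[0,1] q∈ (pow-∈[0,1] q∈ k)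

pow-mono-≤ : ∀ {p q} → 0ℚ ≤ p → p ≤ q → ∀ k → pow p k ≤ pow q k
pow-mono-≤ 0≤p p≤q zero    = ≤-refl
pow-mono-≤ 0≤p p≤q (suc k) = *-mono-≤-nonNeg 0≤p p≤q (pow-nonNeg 0≤p k) (pow-mono-≤ 0≤p p≤q k)

∣pow∣ : ∀ q k → ∣ pow q k ∣ ≡ pow ∣ q ∣ k
∣pow∣ q zero    = refl
∣pow∣ q (suc k) = trans (∣p*q∣≡∣p∣*∣q∣ q (pow q k)) (cong (∣ q ∣ *_) (∣pow∣ q k))

module _ {A : Set} where

  Σ-cong : (xs : List A) {g h : A → ℚ} → (∀ a → g a ≡ h a) → Σ xs g ≡ Σ xs h
  Σ-cong []       g≗h = refl
  Σ-cong (x ∷ xs) g≗h = cong₂ _+_ (g≗h x) (Σ-cong xs g≗h)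

  Σ-+ : (xs : List A) (g h : A → ℚ) → Σ xs (λ a → g a + h a) ≡ Σ xs g + Σ xs h
  Σ-+ []       g h = refl
  Σ-+ (x ∷ xs) g h = trans (cong (λ r → g x + h x + r) (Σ-+ xs g h))
                           (+-interchange (g x) (h x) (Σ xs g) (Σ xs h))

  Σ-*ˡ : (xs : List A) (c : ℚ) (g : A → ℚ) → Σ xs (λ a → c * g a) ≡ c * Σ xs g
  Σ-*ˡ []       c g = sym (*-zeroʳ c)
  Σ-*ˡ (x ∷ xs) c g = trans (cong (λ r → c * g x + r) (Σ-*ˡ xs c g)) (sym (*-distribˡ-+ c (g x) (Σ xs g)))

  Σ-*ʳ : (xs : List A) (g : A → ℚ) (c : ℚ) → Σ xs (λ a → g a * c) ≡ Σ xs g * c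
  Σ-*ʳ xs g c = trans (Σ-cong xs (λ a → *-comm (g a) c)) (trans (Σ-*ˡ xs c g) (*-comm c (Σ xs g)))

  Σ-0 : (xs : List A) → Σ xs (λ _ → 0ℚ) ≡ 0ℚ
  Σ-0 []       = refl
  Σ-0 (x ∷ xs) = cong (λ r → 0ℚ + r) (Σ-0 xs)

  Σ-mono-≤ : (xs : List A) {g h : A → ℚ} → (∀ a → g a ≤ h a) → Σ xs g ≤ Σ xs h
  Σ-mono-≤ []       g≤h = ≤-refl
  Σ-mono-≤ (x ∷ xs) g≤h = +-mono-≤ (g≤h x) (Σ-mono-≤ xs g≤h)

  Σ-nonNeg : (xs : List A) {g : A → ℚ} → (∀ a → 0ℚ ≤ g a) → 0ℚ ≤ Σ xs g
  Σ-nonNeg xs 0≤g = ≤-trans (≤-reflexive (sym (Σ-0 xs))) (Σ-mono-≤ xs 0≤g)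

  ∣Σ∣≤Σ∣∣ : (xs : List A) (g : A → ℚ) → ∣ Σ xs g ∣ ≤ Σ xs (λ a → ∣ g a ∣)
  ∣Σ∣≤Σ∣∣ []       g = ≤-refl
  ∣Σ∣≤Σ∣∣ (x ∷ xs) g =
    ≤-trans (∣p+q∣≤∣p∣+∣q∣ (g x) (Σ xs g)) (+-monoʳ-≤ ∣ g x ∣ (∣Σ∣≤Σ∣∣ xs g))

Σ-swap : {A B : Set} (xs : List A) (ys : List B) (g : A → B → ℚ) →
         Σ xs (λ a → Σ ys (g a)) ≡ Σ ys (λ b → Σ xs (λ a → g a b))
Σ-swap []       ys g = sym (Σ-0 ys)
Σ-swap (x ∷ xs) ys g =
  trans (cong (λ r → Σ ys (g x) + r) (Σ-swap xs ys g)) (sym (Σ-+ ys (g x) (λ b → Σ xs (λ a → g a b))))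

Σ-allCube-suc-paired : ∀ n (G : Cube (suc n) → ℚ) →
  Σ (allCube (suc n)) G ≡ Σ (allCube n) (λ v → G (false ∷ v) + G (true ∷ v))
Σ-allCube-suc-paired n G = go (allCube n)
  where
  go : ∀ vs → Σ (concatMap (λ v → (false ∷ v) ∷ (true ∷ v) ∷ []) vs) G
              ≡ Σ vs (λ v → G (false ∷ v) + G (true ∷ v))
  go []       = refl
  go (v ∷ vs) = trans (cong (λ r → G (false ∷ v) + (G (true ∷ v) + r)) (go vs))
                      (sym (+-assoc (G (false ∷ v)) (G (true ∷ v)) _))

Σ-allCube-suc : ∀ n (G : Cube (suc n) → ℚ) →
  Σ (allCube (suc n)) G ≡ Σ (allCube n) (G ∘ (false ∷_)) + Σ (allCube n) (G ∘ (true ∷_))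
Σ-allCube-suc n G = trans (Σ-allCube-suc-paired n G) (Σ-+ (allCube n) (G ∘ (false ∷_)) (G ∘ (true ∷_)))

Σ-allCube-translate : ∀ n (h : Cube n → ℚ) (y : Cube n) →
  Σ (allCube n) (λ x → h (x · y)) ≡ Σ (allCube n) h
Σ-allCube-translate zero    h []      = refl
Σ-allCube-translate (suc n) h (c ∷ y) = begin
    Σ (allCube (suc n)) (λ x → h (x · (c ∷ y)))
  ≡⟨ Σ-allCube-suc n (λ x → h (x · (c ∷ y))) ⟩
    Σ (allCube n) (λ v → h (xor false c ∷ v · y)) + Σ (allCube n) (λ v → h (xor true c ∷ v · y))
  ≡⟨ cong₂ _+_ (Σ-allCube-translate n (λ v → h (xor false c ∷ v)) y)
               (Σ-allCube-translate n (λ v → h (xor true c ∷ v)) y) ⟩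
    Σ (allCube n) (λ v → h (xor false c ∷ v)) + Σ (allCube n) (λ v → h (xor true c ∷ v))
  ≡⟨ halves c ⟩
    Σ (allCube n) (h ∘ (false ∷_)) + Σ (allCube n) (h ∘ (true ∷_))
  ≡⟨ Σ-allCube-suc n h ⟨
    Σ (allCube (suc n)) h ∎
  where
  open ≡-Reasoning
  halves : ∀ c → Σ (allCube n) (λ v → h (xor false c ∷ v)) + Σ (allCube n) (λ v → h (xor true c ∷ v))
               ≡ Σ (allCube n) (h ∘ (false ∷_)) + Σ (allCube n) (h ∘ (true ∷_))
  halves false = refl
  halves true  = +-comm (Σ (allCube n) (h ∘ (true ∷_))) (Σ (allCube n) (h ∘ (false ∷_)))

nonempty : ∀ {n} → Subset n → Bool
nonempty []      = false
nonempty (s ∷ S) = s ∨ nonempty S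

Σ-allCube-∅ : ∀ n (G : Subset n → ℚ) →
  Σ (allCube n) G ≡ G (∅ n) + Σ (allCube n) (λ S → indicator (nonempty S) * G S)
Σ-allCube-∅ zero    G = cong (λ r → G [] + (r + 0ℚ)) (sym (*-zeroˡ (G [])))
Σ-allCube-∅ (suc n) G = begin
    Σ (allCube (suc n)) G
  ≡⟨ Σ-allCube-suc n G ⟩
    Σ (allCube n) (G ∘ (false ∷_)) + Σ (allCube n) (G ∘ (true ∷_))
  ≡⟨ cong₂ _+_ (Σ-allCube-∅ n (G ∘ (false ∷_)))
               (Σ-cong (allCube n) (λ S → sym (*-identityˡ (G (true ∷ S))))) ⟩
    (G (∅ (suc n)) + Σ (allCube n) (λ S → indicator (nonempty S) * G (false ∷ S)))
      + Σ (allCube n) (λ S → 1ℚ * G (true ∷ S))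
  ≡⟨ +-assoc (G (∅ (suc n))) _ _ ⟩
    G (∅ (suc n)) + (Σ (allCube n) (λ S → indicator (nonempty S) * G (false ∷ S))
                     + Σ (allCube n) (λ S → 1ℚ * G (true ∷ S)))
  ≡⟨ cong (λ r → G (∅ (suc n)) + r) (Σ-allCube-suc n (λ S → indicator (nonempty S) * G S)) ⟨
    G (∅ (suc n)) + Σ (allCube (suc n)) (λ S → indicator (nonempty S) * G S) ∎
  where open ≡-Reasoning

Eu-cong : ∀ n {g h : Cube n → ℚ} → (∀ x → g x ≡ h x) → Eu n g ≡ Eu n h
Eu-cong n g≗h = cong (inv2^ n *_) (Σ-cong (allCube n) g≗h)

Eu-*ˡ : ∀ n (c : ℚ) (g : Cube n → ℚ) → Eu n (λ x → c * g x) ≡ c * Eu n g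
Eu-*ˡ n c g = trans (cong (inv2^ n *_) (Σ-*ˡ (allCube n) c g)) (swap (inv2^ n) c (Σ (allCube n) g))
  where
  swap : ∀ a b s → a * (b * s) ≡ b * (a * s)
  swap = solve-∀ ℚ-ring

Eu-suc : ∀ n (G : Cube (suc n) → ℚ) →
  Eu (suc n) G ≡ ½ * Eu n (G ∘ (false ∷_)) + ½ * Eu n (G ∘ (true ∷_))
Eu-suc n G = trans (cong ((½ * inv2^ n) *_) (Σ-allCube-suc n G))
                   (distrib (inv2^ n) (Σ (allCube n) (G ∘ (false ∷_))) (Σ (allCube n) (G ∘ (true ∷_))))
  where
  distrib : ∀ i a b → (½ * i) * (a + b) ≡ ½ * (i * a) + ½ * (i * b)
  distrib = solve-∀ ℚ-ring

Eu-1 : ∀ n → Eu n (λ _ → 1ℚ) ≡ 1ℚ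
Eu-1 zero    = refl
Eu-1 (suc n) = trans (Eu-suc n (λ _ → 1ℚ)) (cong (λ e → ½ * e + ½ * e) (Eu-1 n))

inv2^-nonNeg : ∀ n → 0ℚ ≤ inv2^ n
inv2^-nonNeg zero    = nonNegative⁻¹ 1ℚ
inv2^-nonNeg (suc n) = *-nonNeg (nonNegative⁻¹ ½) (inv2^-nonNeg n)

∣Eu∣≤1 : ∀ n (g : Cube n → ℚ) → (∀ x → ∣ g x ∣ ≤ 1ℚ) → ∣ Eu n g ∣ ≤ 1ℚ
∣Eu∣≤1 n g ∣g∣≤1 = begin
    ∣ inv2^ n * Σ (allCube n) g ∣
  ≡⟨ ∣p*q∣≡∣p∣*∣q∣ (inv2^ n) _ ⟩
    ∣ inv2^ n ∣ * ∣ Σ (allCube n) g ∣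
  ≡⟨ cong (_* ∣ Σ (allCube n) g ∣) (0≤p⇒∣p∣≡p (inv2^-nonNeg n)) ⟩
    inv2^ n * ∣ Σ (allCube n) g ∣
  ≤⟨ *-monoˡ-≤-nonNeg′ (inv2^-nonNeg n)
       (≤-trans (∣Σ∣≤Σ∣∣ (allCube n) g) (Σ-mono-≤ (allCube n) ∣g∣≤1)) ⟩
    Eu n (λ _ → 1ℚ)
  ≡⟨ Eu-1 n ⟩
    1ℚ ∎
  where open ≤-Reasoning

χ-cons : Bool → Bool → ℚ
χ-cons s b = if s then val b else 1ℚ

χ-· : ∀ {n} (S : Subset n) (x y : Cube n) → χ S (x · y) ≡ χ S x * χ S y
χ-· []      []      []      = refl
χ-· (s ∷ S) (a ∷ x) (b ∷ y) =
  trans (cong₂ _*_ (factor s a b) (χ-· S x y)) (regroup (χ-cons s a) (χ-cons s b) (χ S x) (χ S y))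
  where
  factor : ∀ s a b → χ-cons s (xor a b) ≡ χ-cons s a * χ-cons s b
  factor false a     b     = refl
  factor true  false b     = sym (*-identityˡ (val b))
  factor true  true  false = refl
  factor true  true  true  = refl
  regroup : ∀ p q u v → (p * q) * (u * v) ≡ (p * u) * (q * v)
  regroup = solve-∀ ℚ-ring

χ-χ : ∀ {n} (S : Subset n) (x : Cube n) → χ S x * χ S x ≡ 1ℚ
χ-χ []      []      = refl
χ-χ (s ∷ S) (b ∷ x) = trans (regroup (χ-cons s b) (χ S x)) (cong₂ _*_ (square s b) (χ-χ S x))
  where
  square : ∀ s b → χ-cons s b * χ-cons s b ≡ 1ℚ
  square false b     = refl
  square true  false = refl
  square true  true  = refl
  regroup : ∀ p u → (p * u) * (p * u) ≡ (p * p) * (u * u)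
  regroup = solve-∀ ℚ-ring

∣χ∣ : ∀ {n} (S : Subset n) (x : Cube n) → ∣ χ S x ∣ ≡ 1ℚ
∣χ∣ []      []      = refl
∣χ∣ (s ∷ S) (b ∷ x) =
  trans (∣p*q∣≡∣p∣*∣q∣ (χ-cons s b) (χ S x)) (cong₂ _*_ (∣cons∣ s b) (∣χ∣ S x))
  where
  ∣cons∣ : ∀ s b → ∣ χ-cons s b ∣ ≡ 1ℚ
  ∣cons∣ false b     = refl
  ∣cons∣ true  false = refl
  ∣cons∣ true  true  = refl

χ-∅ : ∀ {n} (x : Cube n) → χ (∅ n) x ≡ 1ℚ
χ-∅ []      = refl
χ-∅ (b ∷ x) = cong (1ℚ *_) (χ-∅ x)

χ-at-1 : ∀ {n} (S : Subset n) → χ S (replicate n false) ≡ 1ℚ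
χ-at-1 []      = refl
χ-at-1 (s ∷ S) = trans (cong (χ-cons s false *_) (χ-at-1 S)) (at-1 s)
  where
  at-1 : ∀ s → χ-cons s false * 1ℚ ≡ 1ℚ
  at-1 false = refl
  at-1 true  = refl

·-identityˡ : ∀ {n} (y : Cube n) → replicate n false · y ≡ y
·-identityˡ []      = refl
·-identityˡ (b ∷ y) = cong (b ∷_) (·-identityˡ y)

fourier-false∷ : ∀ n (f : Cube (suc n) → ℚ) (S : Subset n) →
  fourier (suc n) f (false ∷ S) ≡ ½ * fourier n (f ∘ (false ∷_)) S + ½ * fourier n (f ∘ (true ∷_)) S
fourier-false∷ n f S = trans (Eu-suc n (λ x → f x * χ (false ∷ S) x))
  (cong₂ (λ a b → ½ * a + ½ * b)
    (Eu-cong n (λ v → cong (f (false ∷ v) *_) (*-identityˡ (χ S v))))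
    (Eu-cong n (λ v → cong (f (true ∷ v) *_) (*-identityˡ (χ S v)))))

fourier-true∷ : ∀ n (f : Cube (suc n) → ℚ) (S : Subset n) →
  fourier (suc n) f (true ∷ S) ≡ ½ * fourier n (f ∘ (false ∷_)) S - ½ * fourier n (f ∘ (true ∷_)) S
fourier-true∷ n f S = begin
    fourier (suc n) f (true ∷ S)
  ≡⟨ Eu-suc n (λ x → f x * χ (true ∷ S) x) ⟩
    ½ * Eu n (λ v → f (false ∷ v) * (1ℚ * χ S v)) + ½ * Eu n (λ v → f (true ∷ v) * (- 1ℚ * χ S v))
  ≡⟨ cong₂ (λ a b → ½ * a + ½ * b)
       (Eu-cong n (λ v → cong (f (false ∷ v) *_) (*-identityˡ (χ S v))))
       (trans (Eu-cong n (λ v → pull (f (true ∷ v)) (χ S v))) (Eu-*ˡ n (- 1ℚ) (λ v → f (true ∷ v) * χ S v))) ⟩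
    ½ * fourier n (f ∘ (false ∷_)) S + ½ * (- 1ℚ * fourier n (f ∘ (true ∷_)) S)
  ≡⟨ minus (fourier n (f ∘ (false ∷_)) S) (fourier n (f ∘ (true ∷_)) S) ⟩
    ½ * fourier n (f ∘ (false ∷_)) S - ½ * fourier n (f ∘ (true ∷_)) S ∎
  where
  open ≡-Reasoning
  pull : ∀ a c → a * (- 1ℚ * c) ≡ - 1ℚ * (a * c)
  pull = solve-∀ ℚ-ring
  minus : ∀ a b → ½ * a + ½ * (- 1ℚ * b) ≡ ½ * a - ½ * b
  minus = solve-∀ ℚ-ring

fourier-inversion : ∀ n (f : Cube n → ℚ) (x : Cube n) → Σ (allCube n) (λ S → fourier n f S * χ S x) ≡ f x
fourier-inversion zero    f []      = trivial (f [])
  where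
  trivial : ∀ a → (1ℚ * (a * 1ℚ + 0ℚ)) * 1ℚ + 0ℚ ≡ a
  trivial = solve-∀ ℚ-ring
fourier-inversion (suc n) f (b ∷ x) = begin
    Σ (allCube (suc n)) (λ S → fourier (suc n) f S * χ S (b ∷ x))
  ≡⟨ Σ-allCube-suc-paired n (λ S → fourier (suc n) f S * χ S (b ∷ x)) ⟩
    Σ (allCube n) (λ S → fourier (suc n) f (false ∷ S) * (1ℚ * χ S x)
                         + fourier (suc n) f (true ∷ S) * (val b * χ S x))
  ≡⟨ Σ-cong (allCube n) (λ S → cong₂ (λ p q → p * (1ℚ * χ S x) + q * (val b * χ S x))
                                      (fourier-false∷ n f S) (fourier-true∷ n f S)) ⟩
    Σ (allCube n) (λ S → (½ * f̂₀ S + ½ * f̂₁ S) * (1ℚ * χ S x)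
                         + (½ * f̂₀ S - ½ * f̂₁ S) * (val b * χ S x))
  ≡⟨ Σ-cong (allCube n) (restrict b) ⟩
    Σ (allCube n) (λ S → fourier n (f ∘ (b ∷_)) S * χ S x)
  ≡⟨ fourier-inversion n (f ∘ (b ∷_)) x ⟩
    f (b ∷ x) ∎
  where
  open ≡-Reasoning
  f̂₀ f̂₁ : Subset n → ℚ
  f̂₀ = fourier n (f ∘ (false ∷_))
  f̂₁ = fourier n (f ∘ (true ∷_))
  keep₀ : ∀ a₀ a₁ c → (½ * a₀ + ½ * a₁) * (1ℚ * c) + (½ * a₀ - ½ * a₁) * (1ℚ * c) ≡ a₀ * c
  keep₀ = solve-∀ ℚ-ring
  keep₁ : ∀ a₀ a₁ c → (½ * a₀ + ½ * a₁) * (1ℚ * c) + (½ * a₀ - ½ * a₁) * (- 1ℚ * c) ≡ a₁ * c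
  keep₁ = solve-∀ ℚ-ring
  restrict : ∀ b S → (½ * f̂₀ S + ½ * f̂₁ S) * (1ℚ * χ S x) + (½ * f̂₀ S - ½ * f̂₁ S) * (val b * χ S x)
                     ≡ fourier n (f ∘ (b ∷_)) S * χ S x
  restrict false S = keep₀ (f̂₀ S) (f̂₁ S) (χ S x)
  restrict true  S = keep₁ (f̂₀ S) (f̂₁ S) (χ S x)

-- With w = uniform n f this is the convolution f ∗ g; with w = Zη η it is the noise operator T_η g.
conv : ∀ n → (Cube n → ℚ) → (Cube n → ℚ) → Cube n → ℚ
conv n w g x = Σ (allCube n) (λ y → w y * g (x · y))

uniform : ∀ n → (Cube n → ℚ) → Cube n → ℚ
uniform n f y = inv2^ n * f y

fourier-conv : ∀ n (w g : Cube n → ℚ) (S : Subset n) →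
  fourier n (conv n w g) S ≡ Σ (allCube n) (λ y → w y * χ S y) * fourier n g S
fourier-conv n w g S = begin
    inv2^ n * Σ cube (λ x → conv n w g x * χ S x)
  ≡⟨ cong (inv2^ n *_) (Σ-cong cube (λ x → sym (Σ-*ʳ cube (λ y → w y * g (x · y)) (χ S x)))) ⟩
    inv2^ n * Σ cube (λ x → Σ cube (λ y → (w y * g (x · y)) * χ S x))
  ≡⟨ cong (inv2^ n *_) (Σ-swap cube cube (λ x y → (w y * g (x · y)) * χ S x)) ⟩
    inv2^ n * Σ cube (λ y → Σ cube (λ x → (w y * g (x · y)) * χ S x))
  ≡⟨ cong (inv2^ n *_) (Σ-cong cube shift) ⟩
    inv2^ n * Σ cube (λ y → (w y * χ S y) * Σ cube (λ x → g x * χ S x))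
  ≡⟨ cong (inv2^ n *_) (Σ-*ʳ cube (λ y → w y * χ S y) (Σ cube (λ x → g x * χ S x))) ⟩
    inv2^ n * (Σ cube (λ y → w y * χ S y) * Σ cube (λ x → g x * χ S x))
  ≡⟨ swap (inv2^ n) (Σ cube (λ y → w y * χ S y)) (Σ cube (λ x → g x * χ S x)) ⟩
    Σ cube (λ y → w y * χ S y) * fourier n g S ∎
  where
  open ≡-Reasoning
  cube = allCube n
  swap : ∀ a b c → a * (b * c) ≡ b * (a * c)
  swap = solve-∀ ℚ-ring
  regroup : ∀ w g χx χy → (w * χy) * (g * (χx * χy)) ≡ ((w * g) * χx) * (χy * χy)
  regroup = solve-∀ ℚ-ring
  -- χ_S(x) = χ_S(x·y) χ_S(y) because χ_S(y)² = 1
  recentre : ∀ x y → (w y * g (x · y)) * χ S x ≡ (w y * χ S y) * (g (x · y) * χ S (x · y))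
  recentre x y = sym (begin
      (w y * χ S y) * (g (x · y) * χ S (x · y))
    ≡⟨ cong (λ c → (w y * χ S y) * (g (x · y) * c)) (χ-· S x y) ⟩
      (w y * χ S y) * (g (x · y) * (χ S x * χ S y))
    ≡⟨ regroup (w y) (g (x · y)) (χ S x) (χ S y) ⟩
      ((w y * g (x · y)) * χ S x) * (χ S y * χ S y)
    ≡⟨ cong ((w y * g (x · y)) * χ S x *_) (χ-χ S y) ⟩
      ((w y * g (x · y)) * χ S x) * 1ℚ
    ≡⟨ *-identityʳ _ ⟩
      (w y * g (x · y)) * χ S x ∎)
  shift : ∀ y → Σ cube (λ x → (w y * g (x · y)) * χ S x) ≡ (w y * χ S y) * Σ cube (λ x → g x * χ S x)
  shift y = begin
      Σ cube (λ x → (w y * g (x · y)) * χ S x)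
    ≡⟨ Σ-cong cube (λ x → recentre x y) ⟩
      Σ cube (λ x → (w y * χ S y) * (g (x · y) * χ S (x · y)))
    ≡⟨ Σ-*ˡ cube (w y * χ S y) (λ x → g (x · y) * χ S (x · y)) ⟩
      (w y * χ S y) * Σ cube (λ x → g (x · y) * χ S (x · y))
    ≡⟨ cong ((w y * χ S y) *_) (Σ-allCube-translate n (λ z → g z * χ S z) y) ⟩
      (w y * χ S y) * Σ cube (λ x → g x * χ S x) ∎

Σ-uniform-χ : ∀ n (f : Cube n → ℚ) (S : Subset n) → Σ (allCube n) (λ y → uniform n f y * χ S y) ≡ fourier n f S
Σ-uniform-χ n f S = trans (Σ-cong (allCube n) (λ y → *-assoc (inv2^ n) (f y) (χ S y)))
                          (Σ-*ˡ (allCube n) (inv2^ n) (λ y → f y * χ S y))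

conv-uniform : ∀ n (f h : Cube n → ℚ) (x : Cube n) → conv n (uniform n f) h x ≡ Eu n (λ y → f y * h (x · y))
conv-uniform n f h x = trans (Σ-cong (allCube n) (λ y → *-assoc (inv2^ n) (f y) (h (x · y))))
                             (Σ-*ˡ (allCube n) (inv2^ n) (λ y → f y * h (x · y)))

monomial : ∀ {n} → Subset n → Vec ℚ n → ℚ
monomial S η = Πv (zipWith (λ s e → if s then e else 1ℚ) S η)

Σ-Zη-χ : ∀ n (η : Vec ℚ n) (S : Subset n) → Σ (allCube n) (λ y → Zη η y * χ S y) ≡ monomial S η
Σ-Zη-χ zero    []      []      = refl
Σ-Zη-χ (suc n) (e ∷ η) (s ∷ S) = begin
    Σ (allCube (suc n)) (λ y → Zη (e ∷ η) y * χ (s ∷ S) y)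
  ≡⟨ Σ-allCube-suc n (λ y → Zη (e ∷ η) y * χ (s ∷ S) y) ⟩
    Σ (allCube n) (λ y → (z false * Zη η y) * (χ-cons s false * χ S y))
      + Σ (allCube n) (λ y → (z true * Zη η y) * (χ-cons s true * χ S y))
  ≡⟨ cong₂ _+_ (half false) (half true) ⟩
    (z false * χ-cons s false) * monomial S η + (z true * χ-cons s true) * monomial S η
  ≡⟨ *-distribʳ-+ (monomial S η) (z false * χ-cons s false) (z true * χ-cons s true) ⟨
    (z false * χ-cons s false + z true * χ-cons s true) * monomial S η
  ≡⟨ cong (_* monomial S η) (bit-moment s) ⟩
    monomial (s ∷ S) (e ∷ η) ∎
  where
  open ≡-Reasoning
  z : Bool → ℚ
  z b = ½ * (1ℚ + e * val b)
  regroup : ∀ a Z c χ → (a * Z) * (c * χ) ≡ (a * c) * (Z * χ)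
  regroup = solve-∀ ℚ-ring
  half : ∀ b → Σ (allCube n) (λ y → (z b * Zη η y) * (χ-cons s b * χ S y)) ≡ (z b * χ-cons s b) * monomial S η
  half b = trans (Σ-cong (allCube n) (λ y → regroup (z b) (Zη η y) (χ-cons s b) (χ S y)))
                 (trans (Σ-*ˡ (allCube n) (z b * χ-cons s b) (λ y → Zη η y * χ S y))
                        (cong ((z b * χ-cons s b) *_) (Σ-Zη-χ n η S)))
  moment₀ : ∀ e → ½ * (1ℚ + e * 1ℚ) * 1ℚ + ½ * (1ℚ + e * - 1ℚ) * 1ℚ ≡ 1ℚ
  moment₀ = solve-∀ ℚ-ring
  moment₁ : ∀ e → ½ * (1ℚ + e * 1ℚ) * 1ℚ + ½ * (1ℚ + e * - 1ℚ) * - 1ℚ ≡ e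
  moment₁ = solve-∀ ℚ-ring
  bit-moment : ∀ s → z false * χ-cons s false + z true * χ-cons s true ≡ (if s then e else 1ℚ)
  bit-moment false = moment₀ e
  bit-moment true  = moment₁ e

H-conv : ∀ n (η : Vec ℚ n) (f : Cube n → ℚ) (x : Cube n) →
  H n η f x ≡ conv n (uniform n f) (conv n (uniform n f) (conv n (Zη η) f)) x
H-conv n η f x = sym (begin
    conv n (uniform n f) (conv n (uniform n f) T) x
  ≡⟨ conv-uniform n f (conv n (uniform n f) T) x ⟩
    Eu n (λ y₁ → f y₁ * conv n (uniform n f) T (x · y₁))
  ≡⟨ Eu-cong n (λ y₁ → cong (f y₁ *_) (conv-uniform n f T (x · y₁))) ⟩
    Eu n (λ y₁ → f y₁ * Eu n (λ y₂ → f y₂ * T ((x · y₁) · y₂)))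
  ≡⟨ Eu-cong n (λ y₁ → sym (Eu-*ˡ n (f y₁) (λ y₂ → f y₂ * T ((x · y₁) · y₂)))) ⟩
    Eu n (λ y₁ → Eu n (λ y₂ → f y₁ * (f y₂ * T ((x · y₁) · y₂))))
  ≡⟨ Eu-cong n (λ y₁ → Eu-cong n (λ y₂ → sym (pull (f y₁) (f y₂) ((x · y₁) · y₂)))) ⟩
    H n η f x ∎)
  where
  open ≡-Reasoning
  T : Cube n → ℚ
  T = conv n (Zη η) f
  regroup : ∀ z a b c → z * (a * (b * c)) ≡ a * (b * (z * c))
  regroup = solve-∀ ℚ-ring
  pull : ∀ a b u → Σ (allCube n) (λ y → Zη η y * (a * (b * f (u · y)))) ≡ a * (b * T u)
  pull a b u = trans (Σ-cong (allCube n) (λ y → regroup (Zη η y) a b (f (u · y))))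
                     (trans (Σ-*ˡ (allCube n) a (λ y → b * (Zη η y * f (u · y))))
                            (cong (a *_) (Σ-*ˡ (allCube n) b (λ y → Zη η y * f (u · y)))))

fourier-H : ∀ n (η : Vec ℚ n) (f : Cube n → ℚ) (S : Subset n) →
  fourier n (H n η f) S ≡ pow (fourier n f S) 3 * monomial S η
fourier-H n η f S = begin
    fourier n (H n η f) S
  ≡⟨ Eu-cong n (λ x → cong (_* χ S x) (H-conv n η f x)) ⟩
    fourier n (conv n U (conv n U T)) S
  ≡⟨ fourier-conv n U (conv n U T) S ⟩
    Σ cube (λ y → U y * χ S y) * fourier n (conv n U T) S
  ≡⟨ cong (Σ cube (λ y → U y * χ S y) *_) (fourier-conv n U T S) ⟩
    Σ cube (λ y → U y * χ S y) * (Σ cube (λ y → U y * χ S y) * fourier n T S)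
  ≡⟨ cong₂ (λ a t → a * (a * t)) (Σ-uniform-χ n f S)
       (trans (fourier-conv n (Zη η) f S) (cong (_* fourier n f S) (Σ-Zη-χ n η S))) ⟩
    fourier n f S * (fourier n f S * (monomial S η * fourier n f S))
  ≡⟨ cube-coefficient (fourier n f S) (monomial S η) ⟩
    pow (fourier n f S) 3 * monomial S η ∎
  where
  open ≡-Reasoning
  cube = allCube n
  U = uniform n f
  T = conv n (Zη η) f
  cube-coefficient : ∀ a m → a * (a * (m * a)) ≡ (a * (a * (a * 1ℚ))) * m
  cube-coefficient = solve-∀ ℚ-ring

H-expansion : ∀ n (η : Vec ℚ n) (f : Cube n → ℚ) (x : Cube n) →
  H n η f x ≡ Σ (allCube n) (λ S → (pow (fourier n f S) 3 * monomial S η) * χ S x)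
H-expansion n η f x = trans (sym (fourier-inversion n (H n η f) x))
                            (Σ-cong (allCube n) (λ S → cong (_* χ S x) (fourier-H n η f S)))

parseval : ∀ n (f g : Cube n → ℚ) →
  Σ (allCube n) (λ S → fourier n f S * fourier n g S) ≡ Eu n (λ x → f x * g x)
parseval n f g = begin
    Σ (allCube n) (λ S → fourier n f S * fourier n g S)
  ≡⟨ Σ-cong (allCube n) coefficient ⟨
    Σ (allCube n) (λ S → fourier n (conv n (uniform n f) g) S * χ S 𝟙)
  ≡⟨ fourier-inversion n (conv n (uniform n f) g) 𝟙 ⟩
    conv n (uniform n f) g 𝟙
  ≡⟨ conv-uniform n f g 𝟙 ⟩
    Eu n (λ y → f y * g (𝟙 · y))
  ≡⟨ Eu-cong n (λ y → cong (λ z → f y * g z) (·-identityˡ y)) ⟩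
    Eu n (λ x → f x * g x) ∎
  where
  open ≡-Reasoning
  𝟙 : Cube n
  𝟙 = replicate n false
  coefficient : ∀ S → fourier n (conv n (uniform n f) g) S * χ S 𝟙 ≡ fourier n f S * fourier n g S
  coefficient S = trans (cong₂ _*_ (fourier-conv n (uniform n f) g S) (χ-at-1 S))
                        (trans (*-identityʳ _) (cong (_* fourier n g S) (Σ-uniform-χ n f S)))

IsBoolean : ∀ {n} → (Cube n → ℚ) → Set
IsBoolean f = ∀ x → f x ≡ 1ℚ ⊎ f x ≡ - 1ℚ

boolean-∣∣≤1 : ∀ {n} {f : Cube n → ℚ} → IsBoolean f → ∀ x → ∣ f x ∣ ≤ 1ℚ
boolean-∣∣≤1 boolean x with boolean x
... | inj₁ fx≡1  = ≤-reflexive (cong ∣_∣ fx≡1)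
... | inj₂ fx≡-1 = ≤-reflexive (cong ∣_∣ fx≡-1)

boolean-square : ∀ {n} {f : Cube n → ℚ} → IsBoolean f → ∀ x → f x * f x ≡ 1ℚ
boolean-square boolean x with boolean x
... | inj₁ fx≡1  = cong₂ _*_ fx≡1 fx≡1
... | inj₂ fx≡-1 = cong₂ _*_ fx≡-1 fx≡-1

∣fourier∣≤1 : ∀ n (f : Cube n → ℚ) → (∀ x → ∣ f x ∣ ≤ 1ℚ) → ∀ S → ∣ fourier n f S ∣ ≤ 1ℚ
∣fourier∣≤1 n f ∣f∣≤1 S =
  ∣Eu∣≤1 n (λ x → f x * χ S x) (λ x → ≤-trans (≤-reflexive (∣fχ∣ x)) (∣f∣≤1 x))
  where
  ∣fχ∣ : ∀ x → ∣ f x * χ S x ∣ ≡ ∣ f x ∣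
  ∣fχ∣ x = trans (∣p*q∣≡∣p∣*∣q∣ (f x) (χ S x))
                 (trans (cong (∣ f x ∣ *_) (∣χ∣ S x)) (*-identityʳ ∣ f x ∣))

∣p∣*∣p∣≡p*p : ∀ p → ∣ p ∣ * ∣ p ∣ ≡ p * p
∣p∣*∣p∣≡p*p p with ∣p∣≡p∨∣p∣≡-p p
... | inj₁ ∣p∣≡p  = cong₂ _*_ ∣p∣≡p ∣p∣≡p
... | inj₂ ∣p∣≡-p = trans (cong₂ _*_ ∣p∣≡-p ∣p∣≡-p) (neg-square p)
  where
  neg-square : ∀ p → - p * - p ≡ p * p
  neg-square = solve-∀ ℚ-ring

pow∣∣3≤square : ∀ a → ∣ a ∣ ≤ 1ℚ → pow ∣ a ∣ 3 ≤ a * a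
pow∣∣3≤square a ∣a∣≤1 = begin
    pow ∣ a ∣ 3
  ≡⟨ reassoc ∣ a ∣ ⟩
    (∣ a ∣ * ∣ a ∣) * ∣ a ∣
  ≤⟨ *-monoˡ-≤-nonNeg′ (*-nonNeg (0≤∣p∣ a) (0≤∣p∣ a)) ∣a∣≤1 ⟩
    (∣ a ∣ * ∣ a ∣) * 1ℚ
  ≡⟨ trans (*-identityʳ _) (∣p∣*∣p∣≡p*p a) ⟩
    a * a ∎
  where
  open ≤-Reasoning
  reassoc : ∀ u → u * (u * (u * 1ℚ)) ≡ (u * u) * u
  reassoc = solve-∀ ℚ-ring

Σ∣fourier∣³≤1 : ∀ n (f : Cube n → ℚ) → IsBoolean f →
  Σ (allCube n) (λ S → pow ∣ fourier n f S ∣ 3) ≤ 1ℚ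
Σ∣fourier∣³≤1 n f boolean = begin
    Σ (allCube n) (λ S → pow ∣ fourier n f S ∣ 3)
  ≤⟨ Σ-mono-≤ (allCube n)
       (λ S → pow∣∣3≤square (fourier n f S) (∣fourier∣≤1 n f (boolean-∣∣≤1 boolean) S)) ⟩
    Σ (allCube n) (λ S → fourier n f S * fourier n f S)
  ≡⟨ parseval n f f ⟩
    Eu n (λ x → f x * f x)
  ≡⟨ trans (Eu-cong n (boolean-square boolean)) (Eu-1 n) ⟩
    1ℚ ∎
  where open ≤-Reasoning

indicator-nonNeg : ∀ b → 0ℚ ≤ indicator b
indicator-nonNeg true  = nonNegative⁻¹ 1ℚ
indicator-nonNeg false = ≤-refl

monomial-∅ : ∀ {n} (η : Vec ℚ n) → monomial (∅ n) η ≡ 1ℚ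
monomial-∅ []      = refl
monomial-∅ (e ∷ η) = cong (1ℚ *_) (monomial-∅ η)

monomial-∈[0,1] : ∀ {n} {η : Vec ℚ n} → All _∈[0,1] η → (S : Subset n) → monomial S η ∈[0,1]
monomial-∈[0,1] []        []      = 1∈[0,1]
monomial-∈[0,1] {η = e ∷ η} (e∈ ∷ η∈) (s ∷ S) = *-∈[0,1] (factor s) (monomial-∈[0,1] η∈ S)
  where
  factor : ∀ s → (if s then e else 1ℚ) ∈[0,1]
  factor false = 1∈[0,1]
  factor true  = e∈

monomial-∷-≤ : ∀ {n e} {η : Vec ℚ n} → e ∈[0,1] → ∀ s S →
  0ℚ ≤ monomial S η → monomial (s ∷ S) (e ∷ η) ≤ monomial S η
monomial-∷-≤ e∈ false S 0≤μ = ≤-reflexive (*-identityˡ _)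
monomial-∷-≤ e∈ true  S 0≤μ = ≤-trans (*-monoʳ-≤-nonNeg′ 0≤μ (proj₂ e∈)) (≤-reflexive (*-identityˡ _))

etaOf-∈[0,1] : ∀ {α} → α ∈[0,1] → ∀ {n} (T : Subset n) → All _∈[0,1] (etaOf α T)
etaOf-∈[0,1] α∈ []      = []
etaOf-∈[0,1] {α} α∈ (t ∷ T) = entry t ∷ etaOf-∈[0,1] α∈ T
  where
  entry : ∀ t → (if t then α else 0ℚ) ∈[0,1]
  entry true  = α∈
  entry false = 0∈[0,1]

replicate-∈[0,1] : ∀ {c} → c ∈[0,1] → ∀ n → All _∈[0,1] (replicate n c)
replicate-∈[0,1] c∈ zero    = []
replicate-∈[0,1] c∈ (suc n) = c∈ ∷ replicate-∈[0,1] c∈ n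

nonempty-monomial-≤ : ∀ {c} → c ∈[0,1] → ∀ {n} (S : Subset n) →
  indicator (nonempty S) * monomial S (replicate n c) ≤ c
nonempty-monomial-≤ c∈ []              = proj₁ c∈
nonempty-monomial-≤ {c} c∈ {suc n} (true ∷ S) = begin
    1ℚ * (c * monomial S (replicate n c))
  ≡⟨ *-identityˡ (c * monomial S (replicate n c)) ⟩
    c * monomial S (replicate n c)
  ≤⟨ *-monoˡ-≤-nonNeg′ (proj₁ c∈) (proj₂ (monomial-∈[0,1] (replicate-∈[0,1] c∈ n) S)) ⟩
    c * 1ℚ
  ≡⟨ *-identityʳ c ⟩
    c ∎
  where open ≤-Reasoning
nonempty-monomial-≤ c∈ (false ∷ S) =
  ≤-trans (≤-reflexive (cong (indicator (nonempty S) *_) (*-identityˡ _))) (nonempty-monomial-≤ c∈ S)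

-- Expectation over a random T ⊆ [n] containing each i independently with probability p;
-- probGood m f α p is by definition Ep p (suc m) (λ T → indicator (good m f α (etaOf α T))).
Ep : ℚ → (n : ℕ) → (Subset n → ℚ) → ℚ
Ep p n g = Σ (allCube n) (λ T → weight p T * g T)

weight-nonNeg : ∀ {p} → p ∈[0,1] → ∀ {n} (T : Subset n) → 0ℚ ≤ weight p T
weight-nonNeg     p∈ []      = nonNegative⁻¹ 1ℚ
weight-nonNeg {p} p∈ (t ∷ T) = *-nonNeg (factor t) (weight-nonNeg p∈ T)
  where
  factor : ∀ t → 0ℚ ≤ (if t then p else 1ℚ - p)
  factor true  = proj₁ p∈
  factor false = p≤1⇒0≤1-p (proj₂ p∈)

Ep-cong : ∀ p n {g h : Subset n → ℚ} → (∀ T → g T ≡ h T) → Ep p n g ≡ Ep p n h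
Ep-cong p n g≗h = Σ-cong (allCube n) (λ T → cong (weight p T *_) (g≗h T))

Ep-suc : ∀ p n (g : Subset (suc n) → ℚ) →
  Ep p (suc n) g ≡ (1ℚ - p) * Ep p n (g ∘ (false ∷_)) + p * Ep p n (g ∘ (true ∷_))
Ep-suc p n g = trans (Σ-allCube-suc n (λ T → weight p T * g T)) (cong₂ _+_ (half false (1ℚ - p)) (half true p))
  where
  half : ∀ t q → Σ (allCube n) (λ T → (q * weight p T) * g (t ∷ T)) ≡ q * Ep p n (g ∘ (t ∷_))
  half t q = trans (Σ-cong (allCube n) (λ T → *-assoc q (weight p T) (g (t ∷ T))))
                   (Σ-*ˡ (allCube n) q (λ T → weight p T * g (t ∷ T)))

Ep-nonNeg : ∀ {p} → p ∈[0,1] → ∀ n {g : Subset n → ℚ} → (∀ T → 0ℚ ≤ g T) → 0ℚ ≤ Ep p n g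
Ep-nonNeg p∈ n 0≤g = Σ-nonNeg (allCube n) (λ T → *-nonNeg (weight-nonNeg p∈ T) (0≤g T))

Ep-mono-≤ : ∀ {p} → p ∈[0,1] → ∀ n {g h : Subset n → ℚ} → (∀ T → g T ≤ h T) → Ep p n g ≤ Ep p n h
Ep-mono-≤ p∈ n g≤h = Σ-mono-≤ (allCube n) (λ T → *-monoˡ-≤-nonNeg′ (weight-nonNeg p∈ T) (g≤h T))

Ep-+ : ∀ p n (g h : Subset n → ℚ) → Ep p n (λ T → g T + h T) ≡ Ep p n g + Ep p n h
Ep-+ p n g h = trans (Σ-cong (allCube n) (λ T → *-distribˡ-+ (weight p T) (g T) (h T)))
                     (Σ-+ (allCube n) (λ T → weight p T * g T) (λ T → weight p T * h T))

Ep-*ˡ : ∀ p n (c : ℚ) (g : Subset n → ℚ) → Ep p n (λ T → c * g T) ≡ c * Ep p n g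
Ep-*ˡ p n c g = trans (Σ-cong (allCube n) (λ T → swap (weight p T) c (g T)))
                      (Σ-*ˡ (allCube n) c (λ T → weight p T * g T))
  where
  swap : ∀ a b d → a * (b * d) ≡ b * (a * d)
  swap = solve-∀ ℚ-ring

Ep-const : ∀ p n (c : ℚ) → Ep p n (λ _ → c) ≡ c
Ep-const p zero    c = trans (+-identityʳ _) (*-identityˡ c)
Ep-const p (suc n) c =
  trans (Ep-suc p n (λ _ → c)) (trans (cong (λ e → (1ℚ - p) * e + p * e) (Ep-const p n c)) (mix p c))
  where
  mix : ∀ p c → (1ℚ - p) * c + p * c ≡ c
  mix = solve-∀ ℚ-ring

Ep-Σ : ∀ p n {B : Set} (ys : List B) (g : B → Subset n → ℚ) →
  Ep p n (λ T → Σ ys (λ S → g S T)) ≡ Σ ys (λ S → Ep p n (g S))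
Ep-Σ p n ys g = trans (Σ-cong (allCube n) (λ T → sym (Σ-*ˡ ys (weight p T) (λ S → g S T))))
                      (Σ-swap (allCube n) ys (λ T S → weight p T * g S T))

Ep-monomial-etaOf : ∀ p α n (S : Subset n) →
  Ep p n (λ T → monomial S (etaOf α T)) ≡ monomial S (replicate n (p * α))
Ep-monomial-etaOf p α zero    []      = refl
Ep-monomial-etaOf p α (suc n) (s ∷ S) = begin
    Ep p (suc n) (λ T → monomial (s ∷ S) (etaOf α T))
  ≡⟨ Ep-suc p n (λ T → monomial (s ∷ S) (etaOf α T)) ⟩
    (1ℚ - p) * Ep p n (λ T → e false * M T) + p * Ep p n (λ T → e true * M T)
  ≡⟨ cong₂ (λ u v → (1ℚ - p) * u + p * v) (Ep-*ˡ p n (e false) M) (Ep-*ˡ p n (e true) M) ⟩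
    (1ℚ - p) * (e false * Ep p n M) + p * (e true * Ep p n M)
  ≡⟨ cong (λ X → (1ℚ - p) * (e false * X) + p * (e true * X)) (Ep-monomial-etaOf p α n S) ⟩
    (1ℚ - p) * (e false * X) + p * (e true * X)
  ≡⟨ bit-mean s ⟩
    monomial (s ∷ S) (replicate (suc n) (p * α)) ∎
  where
  open ≡-Reasoning
  e : Bool → ℚ
  e t = if s then (if t then α else 0ℚ) else 1ℚ
  M : Subset n → ℚ
  M T = monomial S (etaOf α T)
  X : ℚ
  X = monomial S (replicate n (p * α))
  mean₀ : ∀ p X → (1ℚ - p) * (1ℚ * X) + p * (1ℚ * X) ≡ 1ℚ * X
  mean₀ = solve-∀ ℚ-ring
  mean₁ : ∀ p α X → (1ℚ - p) * (0ℚ * X) + p * (α * X) ≡ (p * α) * X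
  mean₁ = solve-∀ ℚ-ring
  bit-mean : ∀ s → (1ℚ - p) * ((if s then 0ℚ else 1ℚ) * X) + p * ((if s then α else 1ℚ) * X)
                   ≡ (if s then p * α else 1ℚ) * X
  bit-mean false = mean₀ p X
  bit-mean true  = mean₁ p α X

markov-pointwise : ∀ {θ d} b → 0ℚ ≤ d → (d ≤ θ → b ≡ true) → θ ≤ d + θ * indicator b
markov-pointwise {θ} {d} true 0≤d _ = begin
    θ            ≡⟨ *-identityʳ θ ⟨
    θ * 1ℚ       ≡⟨ +-identityˡ (θ * 1ℚ) ⟨
    0ℚ + θ * 1ℚ  ≤⟨ +-monoˡ-≤ (θ * 1ℚ) 0≤d ⟩
    d + θ * 1ℚ   ∎
  where open ≤-Reasoning
markov-pointwise {θ} {d} false 0≤d d≤θ⇒false≡true with d ≤? θ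
... | yes d≤θ = contradiction (d≤θ⇒false≡true d≤θ) λ ()
... | no  d≰θ = ≤-trans (<⇒≤ (≰⇒> d≰θ)) (p≤p+q (≤-reflexive (sym (*-zeroʳ θ))))

markov : ∀ {p θ} n → p ∈[0,1] → (D : Subset n → ℚ) (E : Subset n → Bool) →
  (∀ T → 0ℚ ≤ D T) → (∀ T → D T ≤ θ → E T ≡ true) → θ ≤ Ep p n D + θ * Ep p n (indicator ∘ E)
markov {p} {θ} n p∈ D E 0≤D small⇒E = begin
    θ
  ≡⟨ Ep-const p n θ ⟨
    Ep p n (λ _ → θ)
  ≤⟨ Ep-mono-≤ p∈ n (λ T → markov-pointwise (E T) (0≤D T) (small⇒E T)) ⟩
    Ep p n (λ T → D T + θ * indicator (E T))
  ≡⟨ Ep-+ p n D (λ T → θ * indicator (E T)) ⟩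
    Ep p n D + Ep p n (λ T → θ * indicator (E T))
  ≡⟨ cong (λ r → Ep p n D + r) (Ep-*ˡ p n θ (indicator ∘ E)) ⟩
    Ep p n D + θ * Ep p n (indicator ∘ E) ∎
  where open ≤-Reasoning

allB-true : ∀ {A : Set} {p : A → Bool} (xs : List A) → (∀ a → p a ≡ true) → allB p xs ≡ true
allB-true           []       p≡true = refl
allB-true {p = p} (a ∷ as) p≡true rewrite p≡true a = allB-true as p≡true

∣indicator*∣≤ : ∀ b {y z} → ∣ y ∣ ≤ z → ∣ indicator b * y ∣ ≤ indicator b * z
∣indicator*∣≤ true  {y} {z} ∣y∣≤z =
  ≤-trans (≤-reflexive (cong ∣_∣ (*-identityˡ y))) (≤-trans ∣y∣≤z (≤-reflexive (sym (*-identityˡ z))))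
∣indicator*∣≤ false {y} {z} _      = ≤-reflexive (trans (cong ∣_∣ (*-zeroˡ y)) (sym (*-zeroˡ z)))

∣cube-term∣ : ∀ a μ c → 0ℚ ≤ μ → ∣ c ∣ ≡ 1ℚ → ∣ (pow a 3 * μ) * c ∣ ≡ pow ∣ a ∣ 3 * μ
∣cube-term∣ a μ c 0≤μ ∣c∣≡1 = begin
    ∣ (pow a 3 * μ) * c ∣
  ≡⟨ ∣p*q∣≡∣p∣*∣q∣ (pow a 3 * μ) c ⟩
    ∣ pow a 3 * μ ∣ * ∣ c ∣
  ≡⟨ cong₂ _*_ (∣p*q∣≡∣p∣*∣q∣ (pow a 3) μ) ∣c∣≡1 ⟩
    (∣ pow a 3 ∣ * ∣ μ ∣) * 1ℚ
  ≡⟨ *-identityʳ _ ⟩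
    ∣ pow a 3 ∣ * ∣ μ ∣
  ≡⟨ cong₂ _*_ (∣pow∣ a 3) (0≤p⇒∣p∣≡p 0≤μ) ⟩
    pow ∣ a ∣ 3 * μ ∎
  where open ≡-Reasoning

module _ {m : ℕ} (f : Cube (suc m) → ℚ) where

  private
    f̂ : Subset (suc m) → ℚ
    f̂ = fourier (suc m) f

    ∣f̂∣³ : Subset (suc m) → ℚ
    ∣f̂∣³ S = pow ∣ f̂ S ∣ 3

    c : Subset m → ℚ
    c S = ∣f̂∣³ (false ∷ S) + ∣f̂∣³ (true ∷ S)

    0≤c : ∀ S → 0ℚ ≤ c S
    0≤c S = +-mono-≤ (pow-nonNeg (0≤∣p∣ (f̂ (false ∷ S))) 3) (pow-nonNeg (0≤∣p∣ (f̂ (true ∷ S))) 3)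

  tailMass : Vec ℚ m → ℚ
  tailMass η = Σ (allCube m) (λ S → indicator (nonempty S) * (c S * monomial S η))

  tailMass-nonNeg : ∀ {η} → All _∈[0,1] η → 0ℚ ≤ tailMass η
  tailMass-nonNeg η∈ = Σ-nonNeg (allCube m)
    (λ S → *-nonNeg (indicator-nonNeg (nonempty S)) (*-nonNeg (0≤c S) (proj₁ (monomial-∈[0,1] η∈ S))))

  H-term : ℚ → Vec ℚ m → Cube (suc m) → Subset (suc m) → ℚ
  H-term α η x S = (pow (f̂ S) 3 * monomial S (α ∷ η)) * χ S x

  H-tail : ℚ → Vec ℚ m → Cube (suc m) → ℚ
  H-tail α η x =
    Σ (allCube m) (λ S → indicator (nonempty S) * (H-term α η x (false ∷ S) + H-term α η x (true ∷ S)))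

  H-split : ∀ α η b x → H (suc m) (α ∷ η) f (b ∷ x)
    ≡ (pow (f̂ (∅ (suc m))) 3 + α * pow (f̂ (single1 m)) 3 * val b) + H-tail α η (b ∷ x)
  H-split α η b x = begin
      H (suc m) (α ∷ η) f (b ∷ x)
    ≡⟨ H-expansion (suc m) (α ∷ η) f (b ∷ x) ⟩
      Σ (allCube (suc m)) t
    ≡⟨ Σ-allCube-suc-paired m t ⟩
      Σ (allCube m) (λ S → t (false ∷ S) + t (true ∷ S))
    ≡⟨ Σ-allCube-∅ m (λ S → t (false ∷ S) + t (true ∷ S)) ⟩
      (t (false ∷ ∅ m) + t (true ∷ ∅ m)) + H-tail α η (b ∷ x)
    ≡⟨ cong (λ μχ → (A³ * (1ℚ * proj₁ μχ)) * (1ℚ * proj₂ μχ) + (B³ * (α * proj₁ μχ)) * (val b * proj₂ μχ)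
                    + H-tail α η (b ∷ x))
            (cong₂ _,_ (monomial-∅ η) (χ-∅ x)) ⟩
      (A³ * (1ℚ * 1ℚ)) * (1ℚ * 1ℚ) + (B³ * (α * 1ℚ)) * (val b * 1ℚ) + H-tail α η (b ∷ x)
    ≡⟨ cong₂ (λ u v → u + v + H-tail α η (b ∷ x)) (empty₀ A³) (empty₁ B³ α (val b)) ⟩
      (A³ + α * B³ * val b) + H-tail α η (b ∷ x) ∎
    where
    open ≡-Reasoning
    A³ = pow (f̂ (∅ (suc m))) 3
    B³ = pow (f̂ (single1 m)) 3
    t = H-term α η (b ∷ x)
    empty₀ : ∀ a → (a * (1ℚ * 1ℚ)) * (1ℚ * 1ℚ) ≡ a
    empty₀ = solve-∀ ℚ-ring
    empty₁ : ∀ a α v → (a * (α * 1ℚ)) * (v * 1ℚ) ≡ α * a * v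
    empty₁ = solve-∀ ℚ-ring

  ∣H-tail∣≤tailMass : ∀ {α η} → α ∈[0,1] → All _∈[0,1] η → ∀ x → ∣ H-tail α η x ∣ ≤ tailMass η
  ∣H-tail∣≤tailMass {α} {η} α∈ η∈ x = begin
      ∣ H-tail α η x ∣
    ≤⟨ ∣Σ∣≤Σ∣∣ (allCube m) (λ S → indicator (nonempty S) * (t (false ∷ S) + t (true ∷ S))) ⟩
      Σ (allCube m) (λ S → ∣ indicator (nonempty S) * (t (false ∷ S) + t (true ∷ S)) ∣)
    ≤⟨ Σ-mono-≤ (allCube m) (λ S → ∣indicator*∣≤ (nonempty S) (pair-≤ S)) ⟩
      tailMass η ∎
    where
    open ≤-Reasoning
    t = H-term α η x
    term-≤ : ∀ s S → ∣ t (s ∷ S) ∣ ≤ ∣f̂∣³ (s ∷ S) * monomial S η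
    term-≤ s S = begin
        ∣ t (s ∷ S) ∣
      ≡⟨ ∣cube-term∣ (f̂ (s ∷ S)) _ (χ (s ∷ S) x)
           (proj₁ (monomial-∈[0,1] (α∈ ∷ η∈) (s ∷ S))) (∣χ∣ (s ∷ S) x) ⟩
        ∣f̂∣³ (s ∷ S) * monomial (s ∷ S) (α ∷ η)
      ≤⟨ *-monoˡ-≤-nonNeg′ (pow-nonNeg (0≤∣p∣ (f̂ (s ∷ S))) 3)
           (monomial-∷-≤ α∈ s S (proj₁ (monomial-∈[0,1] η∈ S))) ⟩
        ∣f̂∣³ (s ∷ S) * monomial S η ∎
    pair-≤ : ∀ S → ∣ t (false ∷ S) + t (true ∷ S) ∣ ≤ c S * monomial S η
    pair-≤ S = begin
        ∣ t (false ∷ S) + t (true ∷ S) ∣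
      ≤⟨ ∣p+q∣≤∣p∣+∣q∣ (t (false ∷ S)) (t (true ∷ S)) ⟩
        ∣ t (false ∷ S) ∣ + ∣ t (true ∷ S) ∣
      ≤⟨ +-mono-≤ (term-≤ false S) (term-≤ true S) ⟩
        ∣f̂∣³ (false ∷ S) * monomial S η + ∣f̂∣³ (true ∷ S) * monomial S η
      ≡⟨ *-distribʳ-+ (monomial S η) (∣f̂∣³ (false ∷ S)) (∣f̂∣³ (true ∷ S)) ⟨
        c S * monomial S η ∎

  ∣H-deviation∣≤tailMass : ∀ {α η} → α ∈[0,1] → All _∈[0,1] η → ∀ b x →
    ∣ H (suc m) (α ∷ η) f (b ∷ x) - pow (f̂ (∅ (suc m))) 3 - α * pow (f̂ (single1 m)) 3 * val b ∣ ≤ tailMass η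
  ∣H-deviation∣≤tailMass {α} {η} α∈ η∈ b x = begin
      ∣ H (suc m) (α ∷ η) f (b ∷ x) - A³ - α * B³ * val b ∣
    ≡⟨ cong (λ h → ∣ h - A³ - α * B³ * val b ∣) (H-split α η b x) ⟩
      ∣ (A³ + α * B³ * val b) + H-tail α η (b ∷ x) - A³ - α * B³ * val b ∣
    ≡⟨ cong ∣_∣ (cancel A³ (α * B³ * val b) (H-tail α η (b ∷ x))) ⟩
      ∣ H-tail α η (b ∷ x) ∣
    ≤⟨ ∣H-tail∣≤tailMass α∈ η∈ (b ∷ x) ⟩
      tailMass η ∎
    where
    open ≤-Reasoning
    A³ = pow (f̂ (∅ (suc m))) 3
    B³ = pow (f̂ (single1 m)) 3
    cancel : ∀ a b r → (a + b) + r - a - b ≡ r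
    cancel = solve-∀ ℚ-ring

  good-if-tailMass-≤ : ∀ {α} → α ∈[0,1] → ∀ T →
    tailMass (etaOf α T) ≤ (α * ¼) * pow ∣ f̂ (single1 m) ∣ 3 → good m f α (etaOf α (true ∷ T)) ≡ true
  good-if-tailMass-≤ α∈ T small = allB-true (allCube (suc m)) λ where
    (b ∷ x) → dec-true (_ ≤? _) (≤-trans (∣H-deviation∣≤tailMass α∈ (etaOf-∈[0,1] α∈ T) b x) small)

  Ep-tailMass-≤ : ∀ {p α} → p ∈[0,1] → α ∈[0,1] →
    Ep p m (λ T → tailMass (etaOf α T)) ≤ (p * α) * Σ (allCube (suc m)) ∣f̂∣³
  Ep-tailMass-≤ {p} {α} p∈ α∈ = begin
      Ep p m (λ T → tailMass (etaOf α T))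
    ≡⟨ Ep-Σ p m (allCube m) (λ S T → indicator (nonempty S) * (c S * monomial S (etaOf α T))) ⟩
      Σ (allCube m) (λ S → Ep p m (λ T → indicator (nonempty S) * (c S * monomial S (etaOf α T))))
    ≡⟨ Σ-cong (allCube m) moment ⟩
      Σ (allCube m) (λ S → (indicator (nonempty S) * c S) * monomial S (replicate m (p * α)))
    ≤⟨ Σ-mono-≤ (allCube m) term-≤ ⟩
      Σ (allCube m) (λ S → c S * (p * α))
    ≡⟨ trans (Σ-*ʳ (allCube m) c (p * α)) (*-comm _ (p * α)) ⟩
      (p * α) * Σ (allCube m) c
    ≡⟨ cong ((p * α) *_) (Σ-allCube-suc-paired m ∣f̂∣³) ⟨
      (p * α) * Σ (allCube (suc m)) ∣f̂∣³ ∎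
    where
    open ≤-Reasoning
    swap : ∀ i a μ → (i * a) * μ ≡ a * (i * μ)
    swap = solve-∀ ℚ-ring
    moment : ∀ S → Ep p m (λ T → indicator (nonempty S) * (c S * monomial S (etaOf α T)))
                   ≡ (indicator (nonempty S) * c S) * monomial S (replicate m (p * α))
    moment S = trans (Ep-cong p m (λ T → sym (*-assoc (indicator (nonempty S)) (c S) (monomial S (etaOf α T)))))
                     (trans (Ep-*ˡ p m (indicator (nonempty S) * c S) (λ T → monomial S (etaOf α T)))
                            (cong ((indicator (nonempty S) * c S) *_) (Ep-monomial-etaOf p α m S)))
    term-≤ : ∀ S → (indicator (nonempty S) * c S) * monomial S (replicate m (p * α)) ≤ c S * (p * α)
    term-≤ S = ≤-trans (≤-reflexive (swap (indicator (nonempty S)) (c S) _))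
                       (*-monoˡ-≤-nonNeg′ (0≤c S) (nonempty-monomial-≤ (*-∈[0,1] p∈ α∈) S))

1/16∈[0,1] : (+ 1 / 16) ∈[0,1]
1/16∈[0,1] = nonNegative⁻¹ (+ 1 / 16) , from-yes (+ 1 / 16 ≤? 1ℚ)

alphaOf-∈[0,1] : ∀ {κ} → κ ∈[0,1] → alphaOf κ ∈[0,1]
alphaOf-∈[0,1] κ∈ = *-∈[0,1] (pow-∈[0,1] κ∈ 3) 1/16∈[0,1]

pOf-∈[0,1] : ∀ {κ} → κ ∈[0,1] → pOf κ ∈[0,1]
pOf-∈[0,1] κ∈ = *-∈[0,1] (pow-∈[0,1] κ∈ 6) 1/16∈[0,1]

pow6≤pow3 : ∀ {κ b} → κ ∈[0,1] → κ ≤ b → pow κ 6 ≤ pow b 3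
pow6≤pow3 {κ} {b} κ∈ κ≤b = begin
    pow κ 6
  ≡⟨ split κ ⟩
    pow κ 3 * pow κ 3
  ≤⟨ *-monoʳ-≤-nonNeg′ (proj₁ (pow-∈[0,1] κ∈ 3)) (proj₂ (pow-∈[0,1] κ∈ 3)) ⟩
    1ℚ * pow κ 3
  ≡⟨ *-identityˡ (pow κ 3) ⟩
    pow κ 3
  ≤⟨ pow-mono-≤ (proj₁ κ∈) κ≤b 3 ⟩
    pow b 3 ∎
  where
  open ≤-Reasoning
  split : ∀ k → k * (k * (k * (k * (k * (k * 1ℚ))))) ≡ (k * (k * (k * 1ℚ))) * (k * (k * (k * 1ℚ)))
  split = solve-∀ ℚ-ring

pα≤θ/4 : ∀ {κ b} → κ ∈[0,1] → κ ≤ b → pOf κ * alphaOf κ ≤ ((alphaOf κ * ¼) * pow b 3) * ¼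
pα≤θ/4 {κ} {b} κ∈ κ≤b = begin
    (pow κ 6 * (+ 1 / 16)) * alphaOf κ
  ≤⟨ *-monoʳ-≤-nonNeg′ (proj₁ (alphaOf-∈[0,1] κ∈))
       (*-monoʳ-≤-nonNeg′ (proj₁ 1/16∈[0,1]) (pow6≤pow3 κ∈ κ≤b)) ⟩
    (pow b 3 * (+ 1 / 16)) * alphaOf κ
  ≡⟨ regroup (pow b 3) (alphaOf κ) ⟩
    ((alphaOf κ * ¼) * pow b 3) * ¼ ∎
  where
  open ≤-Reasoning
  regroup : ∀ u a → (u * (+ 1 / 16)) * a ≡ ((a * ¼) * u) * ¼
  regroup = solve-∀ ℚ-ring

θ≤θ/4+θx⇒¾≤x : ∀ {θ x} → 0ℚ < θ → θ ≤ θ * ¼ + θ * x → ¾ ≤ x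
θ≤θ/4+θx⇒¾≤x {θ} {x} 0<θ θ≤ = *-cancelˡ-≤-pos θ {{positive 0<θ}} (begin
    θ * ¾
  ≡⟨ three-quarters θ ⟩
    θ - θ * ¼
  ≤⟨ +-monoˡ-≤ (- (θ * ¼)) θ≤ ⟩
    (θ * ¼ + θ * x) - θ * ¼
  ≡⟨ cancel θ x ⟩
    θ * x ∎)
  where
  open ≤-Reasoning
  three-quarters : ∀ t → t * ¾ ≡ t - t * ¼
  three-quarters = solve-∀ ℚ-ring
  cancel : ∀ t x → (t * ¼ + t * x) - t * ¼ ≡ t * x
  cancel = solve-∀ ℚ-ring

¾≤Pr[good∣η₁≡α] : ∀ {m} {f : Cube (suc m) → ℚ} {κ} → IsBoolean f → 0ℚ < κ → κ ≤ 1ℚ →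
  κ ≤ ∣ fourier (suc m) f (single1 m) ∣ →
  ¾ ≤ Ep (pOf κ) m (λ T → indicator (good m f (alphaOf κ) (etaOf (alphaOf κ) (true ∷ T))))
¾≤Pr[good∣η₁≡α] {m} {f} {κ} boolean 0<κ κ≤1 κ≤∣f̂₁∣ = θ≤θ/4+θx⇒¾≤x 0<θ (begin
    θ
  ≤⟨ markov m p∈ tail goodₜ (λ T → tailMass-nonNeg f (etaOf-∈[0,1] α∈ T)) (good-if-tailMass-≤ f α∈) ⟩
    Ep p m tail + θ * Ep p m (indicator ∘ goodₜ)
  ≤⟨ +-monoˡ-≤ (θ * Ep p m (indicator ∘ goodₜ)) Ep-tail≤θ/4 ⟩
    θ * ¼ + θ * Ep p m (indicator ∘ goodₜ) ∎)
  where
  open ≤-Reasoning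
  α = alphaOf κ
  p = pOf κ
  θ = (α * ¼) * pow ∣ fourier (suc m) f (single1 m) ∣ 3
  κ∈ : κ ∈[0,1]
  κ∈ = <⇒≤ 0<κ , κ≤1
  α∈ : α ∈[0,1]
  α∈ = alphaOf-∈[0,1] κ∈
  p∈ : p ∈[0,1]
  p∈ = pOf-∈[0,1] κ∈
  0<θ : 0ℚ < θ
  0<θ = *-pos (*-pos (*-pos (pow-pos 0<κ 3) (positive⁻¹ (+ 1 / 16))) (positive⁻¹ ¼))
              (pow-pos (<-≤-trans 0<κ κ≤∣f̂₁∣) 3)
  tail : Subset m → ℚ
  tail T = tailMass f (etaOf α T)
  goodₜ : Subset m → Bool
  goodₜ T = good m f α (etaOf α (true ∷ T))
  Ep-tail≤θ/4 : Ep p m tail ≤ θ * ¼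
  Ep-tail≤θ/4 = begin
      Ep p m tail
    ≤⟨ Ep-tailMass-≤ f p∈ α∈ ⟩
      (p * α) * Σ (allCube (suc m)) (λ S → pow ∣ fourier (suc m) f S ∣ 3)
    ≤⟨ *-monoˡ-≤-nonNeg′ (proj₁ (*-∈[0,1] p∈ α∈)) (Σ∣fourier∣³≤1 (suc m) f boolean) ⟩
      (p * α) * 1ℚ
    ≡⟨ *-identityʳ (p * α) ⟩
      p * α
    ≤⟨ pα≤θ/4 κ∈ κ≤∣f̂₁∣ ⟩
      θ * ¼ ∎

p*Pr[good∣η₁≡α]≤probGood : ∀ m (f : Cube (suc m) → ℚ) α {p} → p ∈[0,1] →
  p * Ep p m (λ T → indicator (good m f α (etaOf α (true ∷ T)))) ≤ probGood m f α p
p*Pr[good∣η₁≡α]≤probGood m f α {p} p∈ = begin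
    p * Ep p m (goodₚ ∘ (true ∷_))
  ≤⟨ p≤p+q (*-nonNeg (p≤1⇒0≤1-p (proj₂ p∈))
                     (Ep-nonNeg p∈ m (indicator-nonNeg ∘ good m f α ∘ etaOf α ∘ (false ∷_)))) ⟩
    p * Ep p m (goodₚ ∘ (true ∷_)) + (1ℚ - p) * Ep p m (goodₚ ∘ (false ∷_))
  ≡⟨ +-comm (p * Ep p m (goodₚ ∘ (true ∷_))) _ ⟩
    (1ℚ - p) * Ep p m (goodₚ ∘ (false ∷_)) + p * Ep p m (goodₚ ∘ (true ∷_))
  ≡⟨ Ep-suc p m goodₚ ⟨
    probGood m f α p ∎
  where
  open ≤-Reasoning
  goodₚ : Subset (suc m) → ℚ
  goodₚ T = indicator (good m f α (etaOf α T))

lemma3p4 : Σ[ c ∈ ℚ ] (0ℚ < c ×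
    ((m : ℕ) (f : Cube (suc m) → ℚ) →
     (∀ x → f x ≡ 1ℚ ⊎ f x ≡ - 1ℚ) →
     (κ : ℚ) → 0ℚ < κ → κ < 1ℚ →
     κ ≤ ∣ fourier (suc m) f (single1 m) ∣ →
     c * pow κ 6 ≤ probGood m f (alphaOf κ) (pOf κ)))
lemma3p4 = + 3 / 64 , positive⁻¹ (+ 3 / 64) , λ m f boolean κ 0<κ κ<1 κ≤∣f̂₁∣ →
  let p∈ = pOf-∈[0,1] (<⇒≤ 0<κ , <⇒≤ κ<1) in begin
    + 3 / 64 * pow κ 6
  ≡⟨ constant (pow κ 6) ⟩
    pOf κ * ¾
  ≤⟨ *-monoˡ-≤-nonNeg′ (proj₁ p∈) (¾≤Pr[good∣η₁≡α] boolean 0<κ (<⇒≤ κ<1) κ≤∣f̂₁∣) ⟩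
    pOf κ * Ep (pOf κ) m (λ T → indicator (good m f (alphaOf κ) (etaOf (alphaOf κ) (true ∷ T))))
  ≤⟨ p*Pr[good∣η₁≡α]≤probGood m f (alphaOf κ) p∈ ⟩
    probGood m f (alphaOf κ) (pOf κ) ∎
  where
  open ≤-Reasoning
  constant : ∀ k → + 3 / 64 * k ≡ (k * (+ 1 / 16)) * ¾
  constant = solve-∀ ℚ-ring
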